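{- Let $k\ge 3$ and let $G$ be a girth-regular graph of order $n$, valency $k$, odd girth $g=2h+1$ and signature $\mathbf{a}=(a_1,a_2,\ldots,a_k)$. Then $$n\ge \frac{k(k-1)^h-2}{k-2}+\left\lceil\frac{k(k-1)^h-\sum_{i=1}^k a_i}{k}\right\rceil.$$
   Context: All graphs are simple, finite and connected, and valency $k>2$ is assumed throughout. For a $k$-regular graph of girth $g$, the signature of a vertex $v$ is the sequence $(a_1,\ldots,a_k)$, listed in non-decreasing order, of the numbers of $g$-cycles containing each of the $k$ edges incident with $v$; the graph is girth-regular if all vertices have the same signature, which is then called the signature of the graph. -}

module Defs where

open import Data.Nat using (ℕ; zero; suc; _+_; _*_; _∸_; _^_; _≤_; _<_; NonZero; s≤s; z≤n)
import Data.Nat as ℕ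
open import Data.Bool using (Bool; true; false; _∧_; not; if_then_else_)
open import Data.Fin using (Fin; _≟_)
open import Data.Fin.Base using ()
open import Data.List using (List; []; _∷_; filter; length; map; allFin; concatMap)
open import Data.Vec using (Vec; []; _∷_; head; last)
open import Data.Integer using (ℤ; +_; -[1+_]; -_)
open import Data.Product using (Σ; _×_; ∃; _,_)
open import Relation.Binary.PropositionalEquality using (_≡_; _≢_; refl)
open import Relation.Nullary using (¬_; does)
open import Relation.Nullary.Decidable using (⌊_⌋)

record SimpleGraph (n : ℕ) : Set where
  field
    Adj   : Fin n → Fin n → Bool
    sym   : ∀ u v → Adj u v ≡ Adj v u
    irrefl : ∀ v → Adj v v ≡ false
open SimpleGraph public

module _ {n : ℕ} (G : SimpleGraph n) where

  data Reach : Fin n → Fin n → Set where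
    here : ∀ {v} → Reach v v
    step : ∀ {u w v} → Adj G u w ≡ true → Reach w v → Reach u v

  Connected : Set
  Connected = ∀ u v → Reach u v

  neighbours : Fin n → List (Fin n)
  neighbours v = filter (λ w → Adj G v w Data.Bool.≟ true) (allFin n)

  degree : Fin n → ℕ
  degree v = length (neighbours v)

  Regular : ℕ → Set
  Regular k = ∀ v → degree v ≡ k

  consecAdj : ∀ {m} → Vec (Fin n) m → Bool
  consecAdj [] = true
  consecAdj (x ∷ []) = true
  consecAdj (x ∷ y ∷ xs) = Adj G x y ∧ consecAdj (y ∷ xs)

  notIn : ∀ {m} → Fin n → Vec (Fin n) m → Bool
  notIn x [] = true
  notIn x (y ∷ ys) = not ⌊ x ≟ y ⌋ ∧ notIn x ys

  distinct : ∀ {m} → Vec (Fin n) m → Bool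
  distinct [] = true
  distinct (x ∷ xs) = notIn x xs ∧ distinct xs

  isPath : ∀ {m} → Vec (Fin n) m → Bool
  isPath xs = distinct xs ∧ consecAdj xs

  IsCycle : (m : ℕ) → Vec (Fin n) m → Set
  IsCycle zero _ = Data.Empty.⊥ where import Data.Empty
  IsCycle (suc m) c = (3 ≤ suc m) × (isPath c ≡ true) × (Adj G (last c) (head c) ≡ true)

  HasCycleOfLength : ℕ → Set
  HasCycleOfLength m = Σ (Vec (Fin n) m) (IsCycle m)

  Girth : ℕ → Set
  Girth g = HasCycleOfLength g × (∀ m → m < g → ¬ HasCycleOfLength m)

allVecs : (n m : ℕ) → List (Vec (Fin n) m)
allVecs n zero = [] ∷ []
allVecs n (suc m) = concatMap (λ x → map (x ∷_) (allVecs n m)) (allFin n)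

module _ {n : ℕ} (G : SimpleGraph n) where

  -- the vertex sequences (u = w₀, w₁, …, w_{g-1} = v) forming a path;
  -- for an edge uv these are in bijection with the g-cycles through uv
  closesCycle : (g : ℕ) → Fin n → Fin n → Vec (Fin n) g → Bool
  closesCycle zero u v _ = false
  closesCycle (suc g) u v w =
    ⌊ head w ≟ u ⌋ ∧ ⌊ last w ≟ v ⌋ ∧ isPath G w

  cyclesThroughEdge : (g : ℕ) → Fin n → Fin n → ℕ
  cyclesThroughEdge g u v =
    length (filter (λ w → closesCycle g u v w Data.Bool.≟ true) (allVecs n g))

  -- the (unsorted) list of numbers of g-cycles through the edges at v
  signatureList : (g : ℕ) → Fin n → List ℕ
  signatureList g v = map (cyclesThroughEdge g v) (neighbours G v)

ceilDiv : ℤ → (d : ℕ) → .{{NonZero d}} → ℤ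
ceilDiv (+ m) d = + ((m + (d ∸ 1)) ℕ./ d)
ceilDiv -[1+ m ] d = - (+ (suc m ℕ./ d))

nonZero-∸2 : ∀ {k} → 3 ≤ k → NonZero (k ∸ 2)
nonZero-∸2 (s≤s (s≤s (s≤s z≤n))) = _

nonZero-3≤ : ∀ {k} → 3 ≤ k → NonZero k
nonZero-3≤ (s≤s _) = _

-- (k (k-1)^h - 2) / (k - 2), for k ≥ 3 (an exact division)
mooreTerm : (k h : ℕ) → 3 ≤ k → ℕ
mooreTerm k h hk = ℕ._/_ (k * (k ∸ 1) ^ h ∸ 2) (k ∸ 2) {{nonZero-∸2 hk}}

ceilTerm : (k h s : ℕ) → 3 ≤ k → ℤ
ceilTerm k h s hk = ceilDiv ((+ (k * (k ∸ 1) ^ h)) Data.Integer.- (+ s)) k {{nonZero-3≤ hk}}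

-- Fix a vertex v and count non-backtracking walks from v. As the girth is 2h+1, two such walks of
-- lengths i and j with i + j < 2h+1 that end at the same vertex coincide, for otherwise they would
-- close up a shorter cycle. So the walks of length at most h end at distinct vertices, and the ball B
-- they reach has at least the Moore number 1 + k Σ_{j<h} (k-1)^j of vertices, the first term of the
-- bound. Of the k(k-1)^h walks of length h+1, one ending outside B is determined by its last edge, so
-- at most k(n - |B|) of them end outside B. One ending at x ∈ B, closed up by the shorter walk from v
-- to x, is forced by the girth to be the initial h+1 steps of a (2h+1)-cycle through v, and these
-- cycles, taken with orientation, number Σ aᵢ. Hence k(k-1)^h ≤ Σ aᵢ + k(n - |B|), which rearranges
-- to the bound.
{-# OPTIONS --safe #-}
module Submission where

open import Defs hiding (sym)
open import Data.Nat using (ℕ; zero; suc; _+_; _*_; _∸_; _^_; _≤_; _<_; s≤s; z≤n; NonZero)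
open import Data.Nat.Properties
  using ( +-comm; +-suc; +-identityʳ; *-comm; *-assoc; +-mono-≤; +-mono-≤-<; +-cancelˡ-≤
        ; ≤-refl; ≤-reflexive; ≤-trans; ≤-antisym; ≤-pred; <-≤-trans; <⇒≤; <⇒≢; <⇒≱; ≰⇒>
        ; n≤1+n; m≤n⇒m≤1+n; m≤m+n; m<m+n; m+n∸n≡m; m+n∸m≡n; m≤pred[n]⇒suc[m]≤n
        ; module ≤-Reasoning )
open import Data.Nat.DivMod using (_/_; m*n/n≡m; m<n*o⇒m/o<n)
open import Data.Nat.ListAction using (sum)
open import Data.Nat.ListAction.Properties using (sum-↭)
open import Data.Nat.Tactic.RingSolver using (solve-∀)
open import Data.Integer using (+_; -[1+_]; _⊖_; +≤+) renaming (_+_ to _+ℤ_; _-_ to _-ℤ_; _≤_ to _≤ℤ_)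
import Data.Integer.Properties as ℤ
open import Data.Bool using (true; _∧_; not)
import Data.Bool as Bool
open import Data.Fin using (Fin; _≟_)
open import Data.Maybe using (just)
open import Data.Maybe.Properties using (just-injective)
open import Data.List as List
  using (List; []; _∷_; _++_; _ʳ++_; length; filter; map; concatMap; allFin; reverse; take)
open import Data.List.Properties
  using ( length-++; length-map; length-tabulate; length-reverse; length-ʳ++; ++-assoc; ++-ʳ++; ʳ++-defn
        ; reverse-involutive; ∷-injective; filter-accept; filter-reject; filter-all )
open import Data.List.Membership.Propositional using (_∈_; _∉_; find)
open import Data.List.Membership.Propositional.Properties
  using ( ∈-∃++; ∈-++⁻; ∈-++⁺ˡ; ∈-++⁺ʳ; ∈-filter⁺; ∈-filter⁻; ∈-map⁺; ∈-map⁻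
        ; ∈-concatMap⁺; ∈-concatMap⁻; ∈-allFin )
import Data.List.Membership.DecPropositional as DecMembership
open import Data.List.Relation.Unary.Any as Any using (here; there)
open import Data.List.Relation.Unary.All as All using (All; []; _∷_)
import Data.List.Relation.Unary.All.Properties as All
open import Data.List.Relation.Unary.AllPairs using ([]; _∷_)
import Data.List.Relation.Unary.AllPairs as AllPairs
import Data.List.Relation.Unary.AllPairs.Properties as AllPairs
open import Data.List.Relation.Unary.Unique.Propositional using (Unique)
import Data.List.Relation.Unary.Unique.Propositional.Properties as Unique
open import Data.List.Relation.Unary.Linked as Linked using (Linked; []; [-]; _∷_)
open import Data.List.Relation.Binary.Subset.Propositional using (_⊆_)
open import Data.List.Relation.Binary.Permutation.Propositional using (_↭_)
open import Data.Vec as Vec using (Vec; fromList; toList)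
open import Data.Vec.Properties using (toList∘fromList)
open import Data.Product using (_×_; _,_; ∃; proj₁; proj₂; uncurry; map₂)
open import Data.Product.Properties using (×-≡,≡→≡)
open import Data.Sum using (inj₁; inj₂)
open import Data.Unit using (⊤)
open import Data.Empty using (⊥-elim)
open import Function using (_∘_; id)
open import Relation.Binary using (Rel; Symmetric; DecidableEquality)
open import Relation.Binary.PropositionalEquality
open import Relation.Nullary using (¬_; ¬?; yes; no)
open import Relation.Nullary.Decidable using (⌊_⌋; dec-true; dec-false; isYes≗does)
open import Relation.Unary using (Pred; Decidable)
open import Relation.Unary.Properties using (∁?)

moore : ℕ → ℕ → ℕ
moore k zero    = 1
moore k (suc j) = moore k j + k * (k ∸ 1) ^ j

moore-identity : ∀ t h → suc (suc t) * suc t ^ h ≡ moore (suc (suc t)) h * t + 2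
moore-identity t zero = base t
  where
  base : ∀ t → suc (suc t) * 1 ≡ 1 * t + 2
  base = solve-∀
moore-identity t (suc h) = begin
  k * (suc t * P)                 ≡⟨ expand t P ⟩
  k * P + t * (k * P)             ≡⟨ cong (_+ t * (k * P)) (moore-identity t h) ⟩
  moore k h * t + 2 + t * (k * P) ≡⟨ regroup (moore k h) t (k * P) ⟩
  (moore k h + k * P) * t + 2     ∎
  where
  open ≡-Reasoning
  k = suc (suc t)
  P = suc t ^ h
  expand : ∀ t P → suc (suc t) * (suc t * P) ≡ suc (suc t) * P + t * (suc (suc t) * P)
  expand = solve-∀
  regroup : ∀ M t X → M * t + 2 + t * X ≡ (M + X) * t + 2
  regroup = solve-∀

mooreTerm≡moore : ∀ k h (hk : 3 ≤ k) → mooreTerm k h hk ≡ moore k h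
mooreTerm≡moore (suc (suc (suc t))) h (s≤s (s≤s (s≤s z≤n))) = begin
  (k * (k ∸ 1) ^ h ∸ 2) / suc t         ≡⟨ cong (λ m → (m ∸ 2) / suc t) (moore-identity (suc t) h) ⟩
  (moore k h * suc t + 2 ∸ 2) / suc t   ≡⟨ cong (_/ suc t) (m+n∸n≡m (moore k h * suc t) 2) ⟩
  moore k h * suc t / suc t             ≡⟨ m*n/n≡m (moore k h) (suc t) ⟩
  moore k h                             ∎
  where
  open ≡-Reasoning
  k = suc (suc (suc t))

ceilDiv≤ : ∀ {x c} k .{{_ : NonZero k}} → x ≤ℤ + (c * k) → ceilDiv x k ≤ℤ + c
ceilDiv≤ {+ m} {c} k (+≤+ m≤ck) = +≤+ (≤-pred (m<n*o⇒m/o<n (begin-strict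
  m + (k ∸ 1) <⟨ +-mono-≤-< m≤ck (m≤pred[n]⇒suc[m]≤n {n = k} ≤-refl) ⟩
  c * k + k   ≡⟨ +-comm (c * k) k ⟩
  suc c * k   ∎)))
  where open ≤-Reasoning
ceilDiv≤ { -[1+ _ ]} k _ = ℤ.neg-≤-pos

m≤n+o⇒m⊖n≤o : ∀ {m n o} → m ≤ n + o → m ⊖ n ≤ℤ + o
m≤n+o⇒m⊖n≤o {m} {n} {o} m≤n+o = ℤ.≤-trans (ℤ.⊖-monoˡ-≤ n m≤n+o)
  (ℤ.≤-reflexive (trans (ℤ.≤-⊖ (m≤m+n n o)) (cong +_ (m+n∸m≡n n o))))

3≤2h+1⇒1≤h : ∀ h → 3 ≤ 2 * h + 1 → 1 ≤ h
3≤2h+1⇒1≤h zero (s≤s ())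
3≤2h+1⇒1≤h (suc h) _ = s≤s z≤n

module _ {a} {A : Set a} where

  Unique-⊆⇒length≤ : ∀ {xs ys : List A} → Unique xs → xs ⊆ ys → length xs ≤ length ys
  Unique-⊆⇒length≤ {[]} _ _ = z≤n
  Unique-⊆⇒length≤ {x ∷ xs} (x∉xs ∷ u) xs⊆ys with ys₁ , ys₂ , refl ← ∈-∃++ (xs⊆ys (here refl)) = begin
    suc (length xs)                ≤⟨ s≤s (Unique-⊆⇒length≤ u xs⊆ys₁ys₂) ⟩
    suc (length (ys₁ ++ ys₂))      ≡⟨ cong suc (length-++ ys₁) ⟩
    suc (length ys₁ + length ys₂)  ≡⟨ +-suc (length ys₁) (length ys₂) ⟨
    length ys₁ + length (x ∷ ys₂)  ≡⟨ length-++ ys₁ ⟨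
    length (ys₁ ++ x ∷ ys₂)        ∎
    where
    open ≤-Reasoning
    xs⊆ys₁ys₂ : xs ⊆ ys₁ ++ ys₂
    xs⊆ys₁ys₂ y∈xs with ∈-++⁻ ys₁ (xs⊆ys (there y∈xs))
    ... | inj₁ y∈ys₁          = ∈-++⁺ˡ y∈ys₁
    ... | inj₂ (here refl)    = ⊥-elim (All.lookup x∉xs y∈xs refl)
    ... | inj₂ (there y∈ys₂)  = ∈-++⁺ʳ ys₁ y∈ys₂

  Unique-++-∷⁻ : ∀ ys {x} {zs : List A} → Unique (ys ++ x ∷ zs) → Unique (x ∷ ys)
  Unique-++-∷⁻ [] _ = [] ∷ []
  Unique-++-∷⁻ (y ∷ ys) (y∉ ∷ u) with x∉ys ∷ uys ← Unique-++-∷⁻ ys u =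
    (x≢y ∷ x∉ys) ∷ All.++⁻ˡ ys y∉ ∷ uys
    where x≢y = λ x≡y → All.lookup y∉ (∈-++⁺ʳ ys (here refl)) (sym x≡y)

  length-filter-≢ : (_≟_ : DecidableEquality A) → ∀ {y} {xs : List A} →
    Unique xs → y ∈ xs → suc (length (filter (λ x → ¬? (x ≟ y)) xs)) ≡ length xs
  length-filter-≢ _≟_ {xs = x ∷ xs} (x∉ ∷ _) (here refl) = cong (suc ∘ length) (begin
    filter ≢x? (x ∷ xs) ≡⟨ filter-reject ≢x? (λ x≢x → x≢x refl) ⟩
    filter ≢x? xs       ≡⟨ filter-all ≢x? (All.map (λ x≢z z≡x → x≢z (sym z≡x)) x∉) ⟩
    xs                  ∎)
    where
    open ≡-Reasoning
    ≢x? = λ z → ¬? (z ≟ x)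
  length-filter-≢ _≟_ {y} {x ∷ xs} (x∉ ∷ u) (there y∈xs) =
    trans (cong (suc ∘ length) (filter-accept (λ z → ¬? (z ≟ y)) (All.lookup x∉ y∈xs)))
          (cong suc (length-filter-≢ _≟_ u y∈xs))

  module _ {p} {P : Pred A p} (P? : Decidable P) where

    length-filter+length-filter-∁ : ∀ xs → length (filter P? xs) + length (filter (∁? P?) xs) ≡ length xs
    length-filter+length-filter-∁ [] = refl
    length-filter+length-filter-∁ (x ∷ xs) with P? x
    ... | yes _ = cong suc (length-filter+length-filter-∁ xs)
    ... | no _  = trans (+-suc _ _) (cong suc (length-filter+length-filter-∁ xs))

  ʳ++-++-assoc : ∀ (xs : List A) {ys zs} → xs ʳ++ (ys ++ zs) ≡ (xs ʳ++ ys) ++ zs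
  ʳ++-++-assoc xs {ys} {zs} = begin
    xs ʳ++ (ys ++ zs)        ≡⟨ ʳ++-defn xs ⟩
    reverse xs ++ (ys ++ zs) ≡⟨ ++-assoc (reverse xs) ys zs ⟨
    (reverse xs ++ ys) ++ zs ≡⟨ cong (_++ zs) (ʳ++-defn xs) ⟨
    (xs ʳ++ ys) ++ zs        ∎
    where open ≡-Reasoning

  reverse-take-ʳ++ : ∀ (xs : List A) {m ys} → length xs ≡ m → reverse (take m (xs ʳ++ ys)) ≡ xs
  reverse-take-ʳ++ xs {ys = ys} refl = begin
    reverse (take (length xs) (xs ʳ++ ys))         ≡⟨ cong (reverse ∘ take (length xs)) (ʳ++-defn xs) ⟩
    reverse (take (length xs) (reverse xs ++ ys))  ≡⟨ cong reverse (take-++ (reverse xs) (length-reverse xs)) ⟩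
    reverse (reverse xs)                           ≡⟨ reverse-involutive xs ⟩
    xs                                             ∎
    where
    open ≡-Reasoning
    take-++ : ∀ zs {m} → length zs ≡ m → take m (zs ++ ys) ≡ zs
    take-++ [] refl = refl
    take-++ (z ∷ zs) refl = cong (z ∷_) (take-++ zs refl)

module _ {a b} {A : Set a} {B : Set b} where

  Unique-map⁺-injectiveOn : ∀ (f : A → B) {xs} → (∀ {x y} → x ∈ xs → y ∈ xs → f x ≡ f y → x ≡ y) →
                            Unique xs → Unique (map f xs)
  Unique-map⁺-injectiveOn f {[]} _ [] = []
  Unique-map⁺-injectiveOn f {x ∷ xs} inj (x∉ ∷ u) =
    All.map⁺ (All.tabulate λ y∈xs fx≡fy → All.lookup x∉ y∈xs (inj (here refl) (there y∈xs) fx≡fy))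
    ∷ Unique-map⁺-injectiveOn f (λ x∈ y∈ → inj (there x∈) (there y∈)) u

  length-concatMap : ∀ (f : A → List B) xs → length (concatMap f xs) ≡ sum (map (length ∘ f) xs)
  length-concatMap f [] = refl
  length-concatMap f (x ∷ xs) = trans (length-++ (f x)) (cong (_+_ (length (f x))) (length-concatMap f xs))

  length-concatMap-const : ∀ (f : A → List B) {c} xs → (∀ {x} → x ∈ xs → length (f x) ≡ c) →
                           length (concatMap f xs) ≡ length xs * c
  length-concatMap-const f [] _ = refl
  length-concatMap-const f (x ∷ xs) len =
    trans (length-++ (f x)) (cong₂ _+_ (len (here refl)) (length-concatMap-const f xs (len ∘ there)))

module _ {a ℓ} {A : Set a} {R : Rel A ℓ} where

  Linked-++⁻ˡ : ∀ xs {ys} → Linked R (xs ++ ys) → Linked R xs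
  Linked-++⁻ˡ [] _ = []
  Linked-++⁻ˡ (x ∷ []) _ = [-]
  Linked-++⁻ˡ (x ∷ y ∷ xs) (r ∷ l) = r ∷ Linked-++⁻ˡ (y ∷ xs) l

  Linked-ʳ++ : Symmetric R → ∀ {x} xs {ys} → Linked R (x ∷ xs) → Linked R (x ∷ ys) → Linked R (xs ʳ++ x ∷ ys)
  Linked-ʳ++ sym [] _ l = l
  Linked-ʳ++ sym (y ∷ xs) (r ∷ l) l′ = Linked-ʳ++ sym xs l (sym r ∷ l′)

module _ {A : Set} where

  NonBacktracking : List A → Set
  NonBacktracking (x ∷ y ∷ z ∷ r) = x ≢ z × NonBacktracking (y ∷ z ∷ r)
  NonBacktracking _ = ⊤

  NonBacktracking-tail : ∀ {x} xs → NonBacktracking (x ∷ xs) → NonBacktracking xs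
  NonBacktracking-tail [] _ = _
  NonBacktracking-tail (_ ∷ []) _ = _
  NonBacktracking-tail (_ ∷ _ ∷ _) (_ , nb) = nb

  NonBacktracking-++⁻ˡ : ∀ xs {ys} → NonBacktracking (xs ++ ys) → NonBacktracking xs
  NonBacktracking-++⁻ˡ [] _ = _
  NonBacktracking-++⁻ˡ (_ ∷ []) _ = _
  NonBacktracking-++⁻ˡ (_ ∷ _ ∷ []) _ = _
  NonBacktracking-++⁻ˡ (_ ∷ y ∷ z ∷ xs) (x≢z , nb) = x≢z , NonBacktracking-++⁻ˡ (y ∷ z ∷ xs) nb

  NonBacktracking-ʳ++ : ∀ {x} xs {ys} → NonBacktracking (x ∷ xs) → NonBacktracking (x ∷ ys) →
                        List.head xs ≢ List.head ys → NonBacktracking (xs ʳ++ x ∷ ys)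
  NonBacktracking-ʳ++ [] _ nb _ = nb
  NonBacktracking-ʳ++ {x} (y ∷ xs) {ys} nbx nb junction =
    NonBacktracking-ʳ++ xs (NonBacktracking-tail (y ∷ xs) nbx) (prepend ys junction nb) (junction′ xs nbx)
    where
    prepend : ∀ ys → just y ≢ List.head ys → NonBacktracking (x ∷ ys) → NonBacktracking (y ∷ x ∷ ys)
    prepend [] _ _ = _
    prepend (z ∷ ys) y≢z nb = (λ y≡z → y≢z (cong just y≡z)) , nb
    junction′ : ∀ xs → NonBacktracking (x ∷ y ∷ xs) → List.head xs ≢ just x
    junction′ [] _ ()
    junction′ (w ∷ xs) (x≢w , _) w≡x = x≢w (sym (just-injective w≡x))

module _ {n} (G : SimpleGraph n) where

  Walk : List (Fin n) → Set
  Walk = Linked (λ x y → Adj G x y ≡ true)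

  Adj-sym : Symmetric (λ x y → Adj G x y ≡ true)
  Adj-sym {x} {y} = trans (SimpleGraph.sym G y x)

  ∈-neighbours⁺ : ∀ {x y} → Adj G x y ≡ true → y ∈ neighbours G x
  ∈-neighbours⁺ {y = y} = ∈-filter⁺ (λ w → Adj G _ w Bool.≟ true) (∈-allFin y)

  ∈-neighbours⁻ : ∀ {x y} → y ∈ neighbours G x → Adj G x y ≡ true
  ∈-neighbours⁻ {x} y∈ = proj₂ (∈-filter⁻ (λ w → Adj G x w Bool.≟ true) {xs = allFin n} y∈)

  Unique-neighbours : ∀ x → Unique (neighbours G x)
  Unique-neighbours x = Unique.filter⁺ _ (Unique.allFin⁺ n)

  notIn-fromList : ∀ {x} l → All (x ≢_) l → notIn G x (fromList l) ≡ true
  notIn-fromList [] [] = refl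
  notIn-fromList {x} (y ∷ l) (x≢y ∷ x∉l) = cong₂ _∧_ (cong not ⌊x≟y⌋≡false) (notIn-fromList l x∉l)
    where ⌊x≟y⌋≡false = trans (isYes≗does (x ≟ y)) (dec-false (x ≟ y) x≢y)

  distinct-fromList : ∀ {l} → Unique l → distinct G (fromList l) ≡ true
  distinct-fromList [] = refl
  distinct-fromList (x∉l ∷ u) = cong₂ _∧_ (notIn-fromList _ x∉l) (distinct-fromList u)

  consecAdj-fromList : ∀ {l} → Walk l → consecAdj G (fromList l) ≡ true
  consecAdj-fromList [] = refl
  consecAdj-fromList [-] = refl
  consecAdj-fromList (xy ∷ w) = cong₂ _∧_ xy (consecAdj-fromList w)

  Adj-last-fromList : ∀ x l {y} → Walk (x ∷ l ++ y ∷ []) → Adj G (Vec.last (fromList (x ∷ l))) y ≡ true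
  Adj-last-fromList x [] (xy ∷ _) = xy
  Adj-last-fromList x (z ∷ l) (_ ∷ w) = Adj-last-fromList z l w

  3≤length-closed : ∀ x l → Walk (x ∷ l ++ x ∷ []) → NonBacktracking (x ∷ l ++ x ∷ []) → 3 ≤ length (x ∷ l)
  3≤length-closed x [] (xx ∷ _) _ with () ← trans (sym (irrefl G x)) xx
  3≤length-closed x (_ ∷ []) _ (x≢x , _) = ⊥-elim (x≢x refl)
  3≤length-closed x (_ ∷ _ ∷ _) _ _ = s≤s (s≤s (s≤s z≤n))

  IsCycle-fromList : ∀ {x l} → Unique (x ∷ l) → Walk (x ∷ l ++ x ∷ []) → NonBacktracking (x ∷ l ++ x ∷ []) →
                     IsCycle G (length (x ∷ l)) (fromList (x ∷ l))
  IsCycle-fromList {x} {l} u w nb =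
      3≤length-closed x l w nb
    , cong₂ _∧_ (distinct-fromList u) (consecAdj-fromList (Linked-++⁻ˡ (x ∷ l) w))
    , Adj-last-fromList x l w

  cycleVertex : ∀ {m} → HasCycleOfLength G m → Fin n
  cycleVertex {suc _} (x Vec.∷ _ , _) = x

  3≤cycleLength : ∀ {m} → HasCycleOfLength G m → 3 ≤ m
  3≤cycleLength {suc _} (_ , 3≤m , _) = 3≤m

  ClosedNBWalk : Fin n → List (Fin n) → Set
  ClosedNBWalk v c = Walk (v ∷ c ++ v ∷ []) × NonBacktracking (v ∷ c ++ v ∷ [])

  -- The g-cycles through v as vertex sequences starting at v, so each cycle occurs once per orientation.
  cyclesAt : (g : ℕ) → Fin n → List (Vec (Fin n) g)
  cyclesAt g v = concatMap (λ u → filter (λ w → closesCycle G g v u w Bool.≟ true) (allVecs n g)) (neighbours G v)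

  length-cyclesAt : ∀ g v → length (cyclesAt g v) ≡ sum (signatureList G g v)
  length-cyclesAt g v = length-concatMap _ (neighbours G v)

  ∈-allVecs : ∀ {m} (w : Vec (Fin n) m) → w ∈ allVecs n m
  ∈-allVecs Vec.[] = here refl
  ∈-allVecs {suc m} (x Vec.∷ w) =
    ∈-concatMap⁺ (λ y → map (y Vec.∷_) (allVecs n m))
                 (Any.map (λ { refl → ∈-map⁺ (x Vec.∷_) (∈-allVecs w) }) (∈-allFin x))

  ∈-cyclesAt : ∀ {m v} {w : Vec (Fin n) (suc m)} → IsCycle G (suc m) w → Vec.head w ≡ v → w ∈ cyclesAt (suc m) v
  ∈-cyclesAt {m} {w = w} (_ , path , closing) refl =
    ∈-concatMap⁺ _ (Any.map (λ { refl → ∈-filter⁺ _ (∈-allVecs w) closes }) (∈-neighbours⁺ (Adj-sym closing)))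
    where
    ⌊≟⌋-refl : ∀ (x : Fin n) → ⌊ x ≟ x ⌋ ≡ true
    ⌊≟⌋-refl x = trans (isYes≗does (x ≟ x)) (dec-true (x ≟ x) refl)
    closes : closesCycle G (suc m) (Vec.head w) (Vec.last w) w ≡ true
    closes = cong₂ _∧_ (⌊≟⌋-refl (Vec.head w)) (cong₂ _∧_ (⌊≟⌋-refl (Vec.last w)) path)

  ∈-cyclesAt-fromList : ∀ {m v c} → suc (length c) ≡ m → IsCycle G (suc (length c)) (fromList (v ∷ c)) →
                        ∃ λ w → w ∈ cyclesAt m v × toList w ≡ v ∷ c
  ∈-cyclesAt-fromList {v = v} {c} refl cycle = fromList (v ∷ c) , ∈-cyclesAt cycle refl , toList∘fromList (v ∷ c)

module Girth {n} (G : SimpleGraph n) {g} (noShortCycle : ∀ m → m < g → ¬ HasCycleOfLength G m) where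

  Unique-shortNBWalk : ∀ c → length c ≤ g → Walk G c → NonBacktracking c → Unique c
  Unique-shortNBWalk [] _ _ _ = []
  Unique-shortNBWalk (x ∷ r) len w nb = All.¬Any⇒All¬ r (x∉r unique-r) ∷ unique-r
    where
    unique-r : Unique r
    unique-r = Unique-shortNBWalk r (≤-trans (n≤1+n _) len) (Linked.tail w) (NonBacktracking-tail r nb)
    -- a second occurrence of x closes up a cycle shorter than the walk
    x∉r : Unique r → x ∉ r
    x∉r u x∈r with ys , zs , refl ← ∈-∃++ x∈r = noShortCycle (length (x ∷ ys)) shorter (fromList (x ∷ ys) , cycle)
      where
      split : x ∷ ys ++ x ∷ zs ≡ (x ∷ ys ++ x ∷ []) ++ zs
      split = cong (x ∷_) (sym (++-assoc ys (x ∷ []) zs))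
      cycle : IsCycle G (length (x ∷ ys)) (fromList (x ∷ ys))
      cycle = IsCycle-fromList G (Unique-++-∷⁻ ys u)
                                 (Linked-++⁻ˡ (x ∷ ys ++ x ∷ []) (subst (Walk G) split w))
                                 (NonBacktracking-++⁻ˡ (x ∷ ys ++ x ∷ []) (subst NonBacktracking split nb))
      shorter : length (x ∷ ys) < g
      shorter = <-≤-trans (s≤s (subst (length ys <_) (sym (length-++ ys)) (m<m+n (length ys) (s≤s z≤n)))) len

  girth≤closedNBWalk : ∀ {v c} → ClosedNBWalk G v c → g ≤ suc (length c)
  girth≤closedNBWalk {v} {c} (w , nb) =
    ≤-pred (subst (g <_) length-closed (≰⇒> λ len≤g → repeated (Unique-shortNBWalk _ len≤g w nb)))
    where
    repeated : ¬ Unique (v ∷ c ++ v ∷ [])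
    repeated (v∉ ∷ _) = All.lookup v∉ (∈-++⁺ʳ c (here refl)) refl
    length-closed : length (v ∷ c ++ v ∷ []) ≡ suc (suc (length c))
    length-closed = cong suc (trans (length-++ c) (+-comm (length c) 1))

  closedNBWalk⇒IsCycle : ∀ {v c} → ClosedNBWalk G v c → suc (length c) ≤ g →
                         IsCycle G (suc (length c)) (fromList (v ∷ c))
  closedNBWalk⇒IsCycle {v} {c} (w , nb) len =
    IsCycle-fromList G (Unique-shortNBWalk (v ∷ c) len (Linked-++⁻ˡ (v ∷ c) w) (NonBacktracking-++⁻ˡ (v ∷ c) nb)) w nb

module NonBacktrackingWalks {n} (G : SimpleGraph n) (v : Fin n) where

  successors : Fin n → List (Fin n) → List (Fin n)
  successors x []      = neighbours G x
  successors x (y ∷ _) = filter (λ z → ¬? (z ≟ y)) (neighbours G x)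

  -- NBWalk j x r: a non-backtracking walk of length j from v to x, stored backwards:
  -- r lists the earlier vertices, latest first, and ends with v.
  data NBWalk : ℕ → Fin n → List (Fin n) → Set where
    start : NBWalk 0 v []
    step  : ∀ {j x r z} → NBWalk j x r → z ∈ successors x r → NBWalk (suc j) z (x ∷ r)

  ∈-successors⇒Adj : ∀ {x} r {z} → z ∈ successors x r → Adj G x z ≡ true
  ∈-successors⇒Adj [] z∈ = ∈-neighbours⁻ G z∈
  ∈-successors⇒Adj {x} (y ∷ _) z∈ =
    ∈-neighbours⁻ G (proj₁ (∈-filter⁻ (λ z → ¬? (z ≟ y)) {xs = neighbours G x} z∈))

  ∈-successors⇒≢ : ∀ {x y} r {z} → z ∈ successors x (y ∷ r) → z ≢ y
  ∈-successors⇒≢ {x} {y} _ z∈ = proj₂ (∈-filter⁻ (λ z → ¬? (z ≟ y)) {xs = neighbours G x} z∈)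

  NBWalk-length : ∀ {j x r} → NBWalk j x r → length r ≡ j
  NBWalk-length start = refl
  NBWalk-length (step w _) = cong suc (NBWalk-length w)

  NBWalk-walk : ∀ {j x r} → NBWalk j x r → Walk G (x ∷ r)
  NBWalk-walk start = [-]
  NBWalk-walk (step {r = r} w z∈) = Adj-sym G (∈-successors⇒Adj r z∈) ∷ NBWalk-walk w

  NBWalk-nonBacktracking : ∀ {j x r} → NBWalk j x r → NonBacktracking (x ∷ r)
  NBWalk-nonBacktracking start = _
  NBWalk-nonBacktracking (step start _) = _
  NBWalk-nonBacktracking (step (step {r = r} w y∈) z∈) = ∈-successors⇒≢ r z∈ , NBWalk-nonBacktracking (step w y∈)

  trail : ∀ {j x r} → NBWalk j x r → List (Fin n)
  trail start = []
  trail (step {z = z} w _) = z ∷ trail w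

  trail-∷ʳ : ∀ {j x r} (w : NBWalk j x r) → x ∷ r ≡ trail w ++ v ∷ []
  trail-∷ʳ start = refl
  trail-∷ʳ (step w _) = cong (_ ∷_) (trail-∷ʳ w)

  length-trail : ∀ {j x r} (w : NBWalk j x r) → length (trail w) ≡ j
  length-trail start = refl
  length-trail (step w _) = cong suc (length-trail w)

  ʳ++-trail : ∀ {j x r} (w : NBWalk j x r) ys → (x ∷ r) ʳ++ ys ≡ v ∷ (trail w ʳ++ ys)
  ʳ++-trail {x = x} {r} w ys = begin
    (x ∷ r) ʳ++ ys                 ≡⟨ cong (_ʳ++ ys) (trail-∷ʳ w) ⟩
    (trail w ++ v ∷ []) ʳ++ ys     ≡⟨ ++-ʳ++ (trail w) ⟩
    v ∷ (trail w ʳ++ ys)           ∎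
    where open ≡-Reasoning

  extend : Fin n × List (Fin n) → List (Fin n × List (Fin n))
  extend (x , r) = map (_, x ∷ r) (successors x r)

  walks : ℕ → List (Fin n × List (Fin n))
  walks zero    = (v , []) ∷ []
  walks (suc j) = concatMap extend (walks j)

  walks-sound : ∀ j {x r} → (x , r) ∈ walks j → NBWalk j x r
  walks-sound zero (here refl) = start
  walks-sound (suc j) xr∈ with (y , s) , ys∈ , xr∈ext ← find (∈-concatMap⁻ extend {xs = walks j} xr∈)
    with z , z∈ , refl ← ∈-map⁻ (_, y ∷ s) xr∈ext = step (walks-sound j ys∈) z∈

  Unique-successors : ∀ x r → Unique (successors x r)
  Unique-successors x [] = Unique-neighbours G x
  Unique-successors x (y ∷ _) = Unique.filter⁺ _ (Unique-neighbours G x)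

  Unique-walks : ∀ j → Unique (walks j)
  Unique-walks zero = [] ∷ []
  Unique-walks (suc j) =
    Unique.concat⁺ (All.map⁺ (All.universal (λ (x , r) → Unique.map⁺ (cong proj₁) (Unique-successors x r)) _))
                   (AllPairs.map⁺ (AllPairs.map disjoint (Unique-walks j)))
    where
    disjoint : ∀ {p q} → p ≢ q → ∀ {w} → ¬ (w ∈ extend p × w ∈ extend q)
    disjoint p≢q (w∈p , w∈q) with _ , _ , refl ← ∈-map⁻ _ w∈p | _ , _ , refl ← ∈-map⁻ _ w∈q = p≢q refl

  module _ {k} (regular : Regular G k) where

    length-successors : ∀ {j x r} → NBWalk (suc j) x r → length (successors x r) ≡ k ∸ 1
    length-successors {x = x} (step {x = y} {r} _ x∈) = cong (_∸ 1) (begin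
      suc (length (filter (λ z → ¬? (z ≟ y)) (neighbours G x)))  ≡⟨ length-filter-≢ _≟_ (Unique-neighbours G x) y∈ ⟩
      degree G x                                                  ≡⟨ regular x ⟩
      k                                                           ∎)
      where
      open ≡-Reasoning
      y∈ = ∈-neighbours⁺ G (Adj-sym G (∈-successors⇒Adj r x∈))

    length-walks : ∀ j → length (walks (suc j)) ≡ k * (k ∸ 1) ^ j
    length-walks zero = begin
      length (walks 1)  ≡⟨ length-concatMap-const extend (walks 0) length-extend ⟩
      1 * k             ≡⟨ *-comm 1 k ⟩
      k * 1             ∎
      where
      open ≡-Reasoning
      length-extend : ∀ {p} → p ∈ walks 0 → length (extend p) ≡ k
      length-extend (here refl) = trans (length-map _ (neighbours G v)) (regular v)
    length-walks (suc j) = begin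
      length (walks (suc (suc j)))           ≡⟨ length-concatMap-const extend (walks (suc j)) length-extend ⟩
      length (walks (suc j)) * (k ∸ 1)       ≡⟨ cong (_* (k ∸ 1)) (length-walks j) ⟩
      k * (k ∸ 1) ^ j * (k ∸ 1)              ≡⟨ *-assoc k _ _ ⟩
      k * ((k ∸ 1) ^ j * (k ∸ 1))            ≡⟨ cong (k *_) (*-comm ((k ∸ 1) ^ j) (k ∸ 1)) ⟩
      k * (k ∸ 1) ^ suc j                    ∎
      where
      open ≡-Reasoning
      length-extend : ∀ {p} → p ∈ walks (suc j) → length (extend p) ≡ k ∸ 1
      length-extend {x , r} p∈ = trans (length-map _ (successors x r)) (length-successors (walks-sound (suc j) p∈))

  ball : ℕ → List (Fin n × List (Fin n))
  ball zero    = walks zero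
  ball (suc j) = ball j ++ walks (suc j)

  ∈-ball⁻ : ∀ j {p} → p ∈ ball j → ∃ λ i → i ≤ j × p ∈ walks i
  ∈-ball⁻ zero p∈ = zero , z≤n , p∈
  ∈-ball⁻ (suc j) p∈ with ∈-++⁻ (ball j) p∈
  ... | inj₁ p∈ball with i , i≤j , p∈walks ← ∈-ball⁻ j p∈ball = i , m≤n⇒m≤1+n i≤j , p∈walks
  ... | inj₂ p∈walks = suc j , ≤-refl , p∈walks

  Unique-ball : ∀ j → Unique (ball j)
  Unique-ball zero = Unique-walks zero
  Unique-ball (suc j) = Unique.++⁺ (Unique-ball j) (Unique-walks (suc j)) shorter
    where
    shorter : ∀ {p} → ¬ (p ∈ ball j × p ∈ walks (suc j))
    shorter {x , r} (p∈ball , p∈walks) with i , i≤j , p∈walksᵢ ← ∈-ball⁻ j p∈ball =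
      <⇒≢ (s≤s i≤j) (trans (sym (NBWalk-length (walks-sound i p∈walksᵢ)))
                           (NBWalk-length (walks-sound (suc j) p∈walks)))

  module _ {k} (regular : Regular G k) where

    length-ball : ∀ j → length (ball j) ≡ moore k j
    length-ball zero = refl
    length-ball (suc j) = trans (length-++ (ball j)) (cong₂ _+_ (length-ball j) (length-walks regular j))

  module BelowGirth {g} (noShortCycle : ∀ m → m < g → ¬ HasCycleOfLength G m) where
    open Girth G noShortCycle

    girth≤returningNBWalk : ∀ {j r} → NBWalk (suc j) v r → g ≤ suc j
    girth≤returningNBWalk w@(step w′ _) = subst (λ m → g ≤ suc m) (length-trail w′) (girth≤closedNBWalk closed)
      where
      closed : ClosedNBWalk G v (trail w′)
      closed = subst (λ l → Walk G (v ∷ l)) (trail-∷ʳ w′) (NBWalk-walk w)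
             , subst (λ l → NonBacktracking (v ∷ l)) (trail-∷ʳ w′) (NBWalk-nonBacktracking w)

    glue : ∀ {i j x y r s z} (wx : NBWalk i x r) (wy : NBWalk j y s) →
           z ∈ successors x r → z ∈ successors y s → x ≢ y → ClosedNBWalk G v (trail wx ʳ++ z ∷ trail wy)
    glue {x = x} {y} {r} {s} {z} wx wy z∈x z∈y x≢y = subst (Walk G) closed-≡ walk , subst NonBacktracking closed-≡ nb
      where
      walk : Walk G ((x ∷ r) ʳ++ z ∷ y ∷ s)
      walk = Linked-ʳ++ (Adj-sym G) (x ∷ r) (NBWalk-walk (step wx z∈x)) (NBWalk-walk (step wy z∈y))
      nb : NonBacktracking ((x ∷ r) ʳ++ z ∷ y ∷ s)
      nb = NonBacktracking-ʳ++ (x ∷ r) (NBWalk-nonBacktracking (step wx z∈x)) (NBWalk-nonBacktracking (step wy z∈y))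
                               (x≢y ∘ just-injective)
      closed-≡ : (x ∷ r) ʳ++ z ∷ y ∷ s ≡ v ∷ (trail wx ʳ++ z ∷ trail wy) ++ v ∷ []
      closed-≡ = begin
        (x ∷ r) ʳ++ z ∷ y ∷ s                       ≡⟨ ʳ++-trail wx _ ⟩
        v ∷ (trail wx ʳ++ z ∷ y ∷ s)                ≡⟨ cong (λ l → v ∷ (trail wx ʳ++ z ∷ l)) (trail-∷ʳ wy) ⟩
        v ∷ (trail wx ʳ++ (z ∷ trail wy) ++ v ∷ []) ≡⟨ cong (v ∷_) (ʳ++-++-assoc (trail wx)) ⟩
        v ∷ (trail wx ʳ++ z ∷ trail wy) ++ v ∷ []   ∎
        where open ≡-Reasoning

    length-glued : ∀ {i j x r y s z} (wx : NBWalk i x r) (wy : NBWalk j y s) →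
                   length (trail wx ʳ++ z ∷ trail wy) ≡ i + suc j
    length-glued wx wy = trans (length-ʳ++ (trail wx)) (cong₂ _+_ (length-trail wx) (cong suc (length-trail wy)))

    NBWalks-coincide : ∀ {i j x r s} → NBWalk i x r → NBWalk j x s → i + j < g → r ≡ s
    NBWalks-coincide start start _ = refl
    NBWalks-coincide start wy@(step _ _) i+j<g = ⊥-elim (<⇒≱ i+j<g (girth≤returningNBWalk wy))
    NBWalks-coincide {suc i} wx@(step _ _) start i+j<g =
      ⊥-elim (<⇒≱ (subst (_< g) (+-identityʳ (suc i)) i+j<g) (girth≤returningNBWalk wx))
    NBWalks-coincide {suc i} {suc j} (step {x = x} wx z∈x) (step {x = y} wy z∈y) i+j<g with x ≟ y
    ... | yes refl = cong (x ∷_) (NBWalks-coincide wx wy (≤-trans (s≤s (+-mono-≤ (n≤1+n i) (n≤1+n j))) i+j<g))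
    ... | no x≢y = ⊥-elim (<⇒≱ i+j<g (subst (λ m → g ≤ suc m) (length-glued wx wy)
                                             (girth≤closedNBWalk (glue wx wy z∈x z∈y x≢y))))

module Counting {n} (G : SimpleGraph n) (v : Fin n) {k} (regular : Regular G k) {h} (1≤h : 1 ≤ h)
                (noShortCycle : ∀ m → m < 2 * h + 1 → ¬ HasCycleOfLength G m) where

  open NonBacktrackingWalks G v
  open DecMembership (_≟_ {n}) using (_∈?_)
  open Girth G noShortCycle
  open BelowGirth noShortCycle

  girth≡ : 2 * h + 1 ≡ suc (h + h)
  girth≡ = double h
    where
    double : ∀ h → 2 * h + 1 ≡ suc (h + h)
    double = solve-∀

  within-girth : ∀ {i j} → i ≤ h → j ≤ h → i + j < 2 * h + 1
  within-girth {i} {j} i≤h j≤h = subst (i + j <_) (sym girth≡) (s≤s (+-mono-≤ i≤h j≤h))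

  ends : List (Fin n)
  ends = map proj₁ (ball h)

  inBall? : Decidable (_∈ ends)
  inBall? = _∈? ends

  endsInBall? : Decidable (λ (p : Fin n × List (Fin n)) → proj₁ p ∈ ends)
  endsInBall? (x , _) = inBall? x

  inside outside : List (Fin n)
  inside  = filter inBall? (allFin n)
  outside = filter (∁? inBall?) (allFin n)

  walksIn walksOut : List (Fin n × List (Fin n))
  walksIn  = filter endsInBall? (walks (suc h))
  walksOut = filter (∁? endsInBall?) (walks (suc h))

  moore≤length-inside : moore k h ≤ length inside
  moore≤length-inside = begin
    moore k h       ≡⟨ length-ball regular h ⟨
    length (ball h) ≡⟨ length-map proj₁ (ball h) ⟨
    length ends     ≤⟨ Unique-⊆⇒length≤ (Unique-map⁺-injectiveOn proj₁ endpoint-injective (Unique-ball h))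
                                         (∈-filter⁺ inBall? (∈-allFin _)) ⟩
    length inside   ∎
    where
    open ≤-Reasoning
    endpoint-injective : ∀ {p q} → p ∈ ball h → q ∈ ball h → proj₁ p ≡ proj₁ q → p ≡ q
    endpoint-injective {x , r} {x , s} p∈ q∈ refl
      with i , i≤h , p∈walks ← ∈-ball⁻ h p∈ | j , j≤h , q∈walks ← ∈-ball⁻ h q∈ =
      cong (x ,_) (NBWalks-coincide (walks-sound i p∈walks) (walks-sound j q∈walks) (within-girth i≤h j≤h))

  arcsFrom : List (Fin n) → List (Fin n × List (Fin n))
  arcsFrom = concatMap (λ x → map (λ y → x , y ∷ []) (neighbours G x))

  -- the last edge of a walk, taken backwards; take 1 r avoids a default value for the walk of length 0
  lastArc : Fin n × List (Fin n) → Fin n × List (Fin n)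
  lastArc (x , r) = x , take 1 r

  lastArc-injective : ∀ {x x′ r s} → NBWalk (suc h) x r → NBWalk (suc h) x′ s →
                      lastArc (x , r) ≡ lastArc (x′ , s) → (x , r) ≡ (x′ , s)
  lastArc-injective (step wy _) (step wy′ _) refl =
    cong (λ t → _ , _ ∷ t) (NBWalks-coincide wy wy′ (within-girth ≤-refl ≤-refl))

  length-walksOut≤ : length walksOut ≤ length outside * k
  length-walksOut≤ = begin
    length walksOut                ≡⟨ length-map lastArc walksOut ⟨
    length (map lastArc walksOut)  ≤⟨ Unique-⊆⇒length≤ unique lastArc-⊆ ⟩
    length (arcsFrom outside)      ≡⟨ length-concatMap-const _ outside (λ {x} _ →
                                        trans (length-map _ (neighbours G x)) (regular x)) ⟩
    length outside * k             ∎
    where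
    open ≤-Reasoning
    sound : ∀ {x r} → (x , r) ∈ walksOut → NBWalk (suc h) x r
    sound p∈ = walks-sound (suc h) (proj₁ (∈-filter⁻ (∁? endsInBall?) {xs = walks (suc h)} p∈))
    unique : Unique (map lastArc walksOut)
    unique = Unique-map⁺-injectiveOn lastArc (λ p∈ q∈ → lastArc-injective (sound p∈) (sound q∈))
                                     (Unique.filter⁺ (∁? endsInBall?) (Unique-walks (suc h)))
    lastArc-⊆ : ∀ {a} → a ∈ map lastArc walksOut → a ∈ arcsFrom outside
    lastArc-⊆ a∈ with (x , r) , p∈ , refl ← ∈-map⁻ lastArc a∈ | sound p∈
    ... | step {r = r′} _ x∈ =
      ∈-concatMap⁺ _ (Any.map (λ { refl → ∈-map⁺ _ y∈ }) (∈-filter⁺ (∁? inBall?) (∈-allFin x) x∉ends))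
      where
      x∉ends = proj₂ (∈-filter⁻ (∁? endsInBall?) {xs = walks (suc h)} p∈)
      y∈ = ∈-neighbours⁺ G (Adj-sym G (∈-successors⇒Adj r′ x∈))

  initialWalk : Vec (Fin n) (2 * h + 1) → List (Fin n)
  initialWalk w = reverse (take (2 + h) (toList w))

  initialWalk-glued : ∀ {j x y r s z} (wy : NBWalk h y r) (wy′ : NBWalk j x s) {w} →
                      toList w ≡ v ∷ (trail wy ʳ++ z ∷ trail wy′) → initialWalk w ≡ z ∷ y ∷ r
  initialWalk-glued {y = y} {r} {z = z} wy wy′ {w} toList-w = begin
    reverse (take (2 + h) (toList w))                          ≡⟨ cong (reverse ∘ take (2 + h)) toList-w ⟩
    reverse (take (2 + h) (v ∷ (trail wy ʳ++ z ∷ trail wy′)))  ≡⟨ cong (reverse ∘ take (2 + h)) (ʳ++-trail wy _) ⟨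
    reverse (take (2 + h) ((z ∷ y ∷ r) ʳ++ trail wy′))         ≡⟨ reverse-take-ʳ++ (z ∷ y ∷ r) length-walk ⟩
    z ∷ y ∷ r                                                  ∎
    where
    open ≡-Reasoning
    length-walk : length (z ∷ y ∷ r) ≡ 2 + h
    length-walk = cong (suc ∘ suc) (NBWalk-length wy)

  closing-cycle : ∀ {j x r s} → NBWalk (suc h) x r → NBWalk j x s → j ≤ h →
                  ∃ λ w → w ∈ cyclesAt G (2 * h + 1) v × initialWalk w ≡ x ∷ r
  closing-cycle wx start _ =
    ⊥-elim (<⇒≱ (m<m+n h 1≤h) (≤-pred (subst (_≤ suc h) girth≡ (girth≤returningNBWalk wx))))
  closing-cycle {x = z} (step {x = y} {r} wy z∈y) (step {j} {x = y′} {s} wy′ z∈y′) j<h with y ≟ y′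
  ... | yes refl = ⊥-elim (<⇒≢ j<h (begin
    j        ≡⟨ NBWalk-length wy′ ⟨
    length s ≡⟨ cong length (NBWalks-coincide wy wy′ (within-girth ≤-refl (<⇒≤ j<h))) ⟨
    length r ≡⟨ NBWalk-length wy ⟩
    h        ∎))
    where open ≡-Reasoning
  ... | no y≢y′ = map₂ (map₂ (initialWalk-glued wy wy′))
                       (∈-cyclesAt-fromList G length-cycle (closedNBWalk⇒IsCycle closed (≤-reflexive length-cycle)))
    where
    closed : ClosedNBWalk G v (trail wy ʳ++ z ∷ trail wy′)
    closed = glue wy wy′ z∈y z∈y′ y≢y′
    1+j≡h : suc j ≡ h
    1+j≡h = ≤-antisym j<h (+-cancelˡ-≤ h h (suc j)
      (≤-pred (subst₂ _≤_ girth≡ (cong suc (length-glued wy wy′)) (girth≤closedNBWalk closed))))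
    length-cycle : suc (length (trail wy ʳ++ z ∷ trail wy′)) ≡ 2 * h + 1
    length-cycle = trans (cong suc (trans (length-glued wy wy′) (cong (_+_ h) 1+j≡h))) (sym girth≡)

  length-walksIn≤ : length walksIn ≤ sum (signatureList G (2 * h + 1) v)
  length-walksIn≤ = begin
    length walksIn                                      ≡⟨ length-map (uncurry _∷_) walksIn ⟨
    length (map (uncurry _∷_) walksIn)                  ≤⟨ Unique-⊆⇒length≤ unique initialWalk-⊇ ⟩
    length (map initialWalk (cyclesAt G (2 * h + 1) v)) ≡⟨ length-map initialWalk (cyclesAt G (2 * h + 1) v) ⟩
    length (cyclesAt G (2 * h + 1) v)                   ≡⟨ length-cyclesAt G _ v ⟩
    sum (signatureList G (2 * h + 1) v)                 ∎
    where
    open ≤-Reasoning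
    unique : Unique (map (uncurry _∷_) walksIn)
    unique = Unique.map⁺ (×-≡,≡→≡ ∘ ∷-injective) (Unique.filter⁺ endsInBall? (Unique-walks (suc h)))
    initialWalk-⊇ : ∀ {l} → l ∈ map (uncurry _∷_) walksIn → l ∈ map initialWalk (cyclesAt G (2 * h + 1) v)
    initialWalk-⊇ l∈ with (x , r) , p∈ , refl ← ∈-map⁻ (uncurry _∷_) l∈
      with p∈walks , x∈ends ← ∈-filter⁻ endsInBall? {xs = walks (suc h)} p∈
      with (x , s) , q∈ball , refl ← ∈-map⁻ proj₁ x∈ends
      with j , j≤h , q∈walks ← ∈-ball⁻ h q∈ball
      with w , w∈ , w↦p ← closing-cycle (walks-sound (suc h) p∈walks) (walks-sound j q∈walks) j≤h
      = subst (_∈ _) w↦p (∈-map⁺ initialWalk w∈)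

  length-walksIn+walksOut : length walksIn + length walksOut ≡ k * (k ∸ 1) ^ h
  length-walksIn+walksOut = trans (length-filter+length-filter-∁ endsInBall? (walks (suc h))) (length-walks regular h)

  length-inside+outside : length inside + length outside ≡ n
  length-inside+outside = trans (length-filter+length-filter-∁ inBall? (allFin n)) (length-tabulate id)

  walks≤cycles+exits : k * (k ∸ 1) ^ h ≤ sum (signatureList G (2 * h + 1) v) + length outside * k
  walks≤cycles+exits = subst (_≤ sum (signatureList G (2 * h + 1) v) + length outside * k) length-walksIn+walksOut
                             (+-mono-≤ length-walksIn≤ length-walksOut≤)

-- The bound is established at a single vertex.
theorem4p2 : (n k h : ℕ) (a : List ℕ) (G : SimpleGraph n) →
    (hk : 3 ≤ k) → Connected G → Regular G k →
    Girth G (2 * h + 1) →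
    Linked _≤_ a → (∀ v → signatureList G (2 * h + 1) v ↭ a) →
    + mooreTerm k h hk +ℤ ceilTerm k h (sum a) hk ≤ℤ + n
theorem4p2 n k h a G hk _ regular (cycle , noShortCycle) _ signature = begin
  + mooreTerm k h hk +ℤ ceilTerm k h (sum a) hk  ≡⟨ cong₂ (λ M s → + M +ℤ ceilTerm k h s hk)
                                                          (mooreTerm≡moore k h hk) (sym (sum-↭ (signature v))) ⟩
  + moore k h +ℤ ceilTerm k h S hk               ≤⟨ ℤ.+-mono-≤ (+≤+ moore≤length-inside)
                                                              (ceilDiv≤ k {{nonZero-3≤ hk}} excess≤) ⟩
  + length inside +ℤ + length outside             ≡⟨ ℤ.pos-+ (length inside) (length outside) ⟨
  + (length inside + length outside)              ≡⟨ cong +_ length-inside+outside ⟩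
  + n                                             ∎
  where
  open ℤ.≤-Reasoning
  v : Fin n
  v = cycleVertex G cycle
  open Counting G v regular (3≤2h+1⇒1≤h h (3≤cycleLength G cycle)) noShortCycle
  S : ℕ
  S = sum (signatureList G (2 * h + 1) v)
  excess≤ : + (k * (k ∸ 1) ^ h) -ℤ + S ≤ℤ + (length outside * k)
  excess≤ = subst (_≤ℤ + (length outside * k)) (sym (ℤ.m-n≡m⊖n _ S)) (m≤n+o⇒m⊖n≤o walks≤cycles+exits)
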